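{- Let $G$ be a connected graph of order $n$ with $m$ edges, minimum degree $\delta$ and maximum degree $\Delta$. Then \[ AG(G) \le \frac{1}{2\delta}\sqrt{F + 2M_2 + 4m(m-1)\Delta^2}, \] with equality if and only if $G$ is a regular graph.
   Context: All graphs are finite, simple and undirected. $d_i$ is the degree of vertex $v_i$; $i\sim j$ denotes an edge $v_iv_j$ and sums over $i\sim j$ run over edges, each once. $AG(G)=\sum_{i\sim j}\frac12\left(\sqrt{d_i/d_j}+\sqrt{d_j/d_i}\right)$, $F(G)=\sum_i d_i^3$, $M_2(G)=\sum_{i\sim j} d_id_j$. -}

module Defs where

open import Data.Bool using (Bool; true; false; T; _∧_)
open import Data.Nat as ℕ using (ℕ; _⊔_; _⊓_; _<ᵇ_)
open import Data.Fin using (Fin; toℕ)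
open import Data.List using (List; []; _∷_; map; foldr; length; filterᵇ; allFin; concatMap)
open import Data.List.Relation.Binary.Pointwise using (Pointwise)
open import Data.Product using (_×_; _,_; proj₁; proj₂)
open import Data.Integer using (+_)
open import Data.Rational as ℚ using (ℚ; 0ℚ; _/_)
open import Relation.Binary.PropositionalEquality using (_≡_)
open import Relation.Binary.Construct.Closure.ReflexiveTransitive using (Star)

record Graph (n : ℕ) : Set where
  field
    adj     : Fin n → Fin n → Bool
    sym     : ∀ i j → adj i j ≡ adj j i
    irrefl  : ∀ i → adj i i ≡ false

open Graph public

module _ {n : ℕ} (G : Graph n) where

  deg : Fin n → ℕ
  deg i = length (filterᵇ (adj G i) (allFin n))

  edges : List (Fin n × Fin n)
  edges = filterᵇ (λ e → adj G (proj₁ e) (proj₂ e) ∧ (toℕ (proj₁ e) <ᵇ toℕ (proj₂ e)))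
                  (concatMap (λ i → map (λ j → (i , j)) (allFin n)) (allFin n))

  m : ℕ
  m = length edges

  degrees : List ℕ
  degrees = map deg (allFin n)

  Δ : ℕ
  Δ = foldr _⊔_ 0 degrees

  -- minimum degree δ (seeded with Δ; correct whenever n ≥ 1)
  δ : ℕ
  δ = foldr _⊓_ Δ degrees

  F : ℕ
  F = foldr ℕ._+_ 0 (map (λ d → d ℕ.* d ℕ.* d) degrees)

  M₂ : ℕ
  M₂ = foldr ℕ._+_ 0 (map (λ e → deg (proj₁ e) ℕ.* deg (proj₂ e)) edges)

  Connected : Set
  Connected = ∀ i j → Star (λ a b → T (adj G a b)) i j

  Regular : Set
  Regular = ∀ i j → deg i ≡ deg j

-- A radicand (p , q) with q > 0 stands for the real number √(p / q);
-- a list of radicands stands for the real number Σ_k √(p_k / q_k).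

Radicand : Set
Radicand = ℕ × ℕ

SqrtSum : Set
SqrtSum = List Radicand

ℕtoℚ : ℕ → ℚ
ℕtoℚ k = + k / 1

sumℚ : List ℚ → ℚ
sumℚ = foldr ℚ._+_ 0ℚ

LowerApprox : ℚ → Radicand → Set
LowerApprox s (p , q) = (0ℚ ℚ.≤ s) × (s ℚ.* s ℚ.* ℕtoℚ q ℚ.≤ ℕtoℚ p)

UpperApprox : ℚ → Radicand → Set
UpperApprox u (p , q) = (0ℚ ℚ.≤ u) × (ℕtoℚ p ℚ.≤ u ℚ.* u ℚ.* ℕtoℚ q)

-- Σ √(a_k) ≤ Σ √(b_l) (as real numbers) iff every sum of termwise rational
-- lower bounds of the left side is ≤ every sum of termwise rational upper
-- bounds of the right side (density of ℚ in ℝ).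
_≤√_ : SqrtSum → SqrtSum → Set
xs ≤√ ys = ∀ (ss us : List ℚ) → Pointwise LowerApprox ss xs → Pointwise UpperApprox us ys
           → sumℚ ss ℚ.≤ sumℚ us

_≈√_ : SqrtSum → SqrtSum → Set
xs ≈√ ys = (xs ≤√ ys) × (ys ≤√ xs)

module _ {n : ℕ} (G : Graph n) where

  -- AG(G) = Σ_{i∼j} ½(√(d_i/d_j) + √(d_j/d_i)) = Σ_{i∼j} √((d_i+d_j)² / (4 d_i d_j))
  AG : SqrtSum
  AG = map (λ e → let a = deg G (proj₁ e) ; b = deg G (proj₂ e)
                  in ((a ℕ.+ b) ℕ.* (a ℕ.+ b) , 4 ℕ.* a ℕ.* b)) (edges G)

  -- (1/(2δ)) √(F + 2 M₂ + 4 m (m-1) Δ²) = √((F + 2M₂ + 4m(m-1)Δ²) / (4 δ²))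
  AGBound : SqrtSum
  AGBound = ( F G ℕ.+ 2 ℕ.* M₂ G ℕ.+ 4 ℕ.* m G ℕ.* (m G ℕ.∸ 1) ℕ.* (Δ G ℕ.* Δ G)
            , 4 ℕ.* δ G ℕ.* δ G ) ∷ []

{-# OPTIONS --safe #-}
module Submission where

-- An edge term t = (a + b)/(2√(ab)) of AG is at least 1, so t ≤ t² = (a + b)²/(4ab) ≤ (a + b)/(2δ),
-- the last step being strict unless a = b = δ.  Summing over the edges gives AG ≤ M₁/(2δ) with
-- M₁ = Σ_{ij}(d_i + d_j); expanding M₁² = Σ_{ij}(d_i + d_j)² + (cross terms) and bounding each of
-- the m(m - 1) cross terms by (2Δ)² gives M₁² ≤ F + 2M₂ + 4m(m - 1)Δ², because
-- Σ_{ij}(d_i² + d_j²) = F by the handshake identity.  Every quantity in this chain except the two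
-- sides themselves is rational, and these rationals are the approximations that witness _≤√_.
-- If the bound is attained, none of the steps t² ≤ (a + b)/(2δ) is strict, so both ends of every
-- edge have degree δ; a connected graph on at least two vertices has no isolated vertex, so G is
-- δ-regular.
-- Conversely, for a c-regular graph both sides equal m.

open import Defs hiding (sym)
open import Data.Nat as ℕ using (ℕ; zero; suc; _+_; _*_; _∸_; _≤_; _<_; _<ᵇ_; NonZero)
import Data.Nat.Properties as ℕ
open import Data.Nat.ListAction using (sum)
import Data.Nat.ListAction.Properties as ListAction
open import Data.Nat.Solver using () renaming (module +-*-Solver to ℕ-Solver)
import Data.Nat.Coprimality as Coprime
import Data.Integer as ℤ
import Data.Integer.Properties as ℤ
open import Data.Rational as ℚ using (ℚ; 0ℚ; 1ℚ)
import Data.Rational.Properties as ℚ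
open import Data.Rational.Solver using () renaming (module +-*-Solver to ℚ-Solver)
import Data.Rational.Unnormalised as ℚᵘ
import Data.Rational.Unnormalised.Properties as ℚᵘ
open import Data.Bool using (Bool; true; false; T; _∧_; if_then_else_)
open import Data.Bool.Properties using (T-∧)
open import Data.Empty using (⊥; ⊥-elim)
open import Data.Fin using (Fin; toℕ) renaming (zero to fzero; suc to fsuc)
import Data.Fin.Properties as Fin
open import Data.List using (List; []; _∷_; _++_; map; length; filterᵇ; concatMap; allFin)
import Data.List.Properties as List
open import Data.List.Membership.Propositional using (_∈_)
open import Data.List.Membership.Propositional.Properties using (∈-filter⁺; ∈-concatMap⁺; ∈-map⁺; ∈-allFin)
open import Data.List.Relation.Binary.Pointwise using (Pointwise; []; _∷_)
open import Data.List.Relation.Unary.All as All using (All; []; _∷_)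
import Data.List.Relation.Unary.All.Properties as All
open import Data.List.Relation.Unary.Any as Any using (here; there)
open import Data.Product using (_×_; _,_; proj₁; proj₂; ∃; ∃-syntax)
open import Data.Sum using (_⊎_; inj₁; inj₂)
open import Function using (_∘_)
open import Function.Bundles using (_⇔_; mk⇔; Equivalence)
open import Relation.Nullary using (ofʸ; ofⁿ; T?)
open import Relation.Binary.Definitions using (tri<; tri≈; tri>)
open import Relation.Binary.Construct.Closure.ReflexiveTransitive using (Star; ε; _◅_)
open import Relation.Binary.PropositionalEquality
open import Algebra.Properties.CommutativeSemigroup ℕ.+-commutativeSemigroup using (interchange)

toℚᵘ-ℕtoℚ : ∀ k → ℚ.toℚᵘ (ℕtoℚ k) ≡ ℚᵘ.mkℚᵘ (ℤ.+ k) 0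
toℚᵘ-ℕtoℚ k = cong ℚ.toℚᵘ (ℚ.normalize-coprime (Coprime.sym (Coprime.1-coprimeTo k)))

ℕtoℚ-+ : ∀ a b → ℕtoℚ (a + b) ≡ ℕtoℚ a ℚ.+ ℕtoℚ b
ℕtoℚ-+ a b = ℚ.toℚᵘ-injective (begin
  ℚ.toℚᵘ (ℕtoℚ (a + b))                        ≡⟨ toℚᵘ-ℕtoℚ (a + b) ⟩
  ℚᵘ.mkℚᵘ (ℤ.+ (a + b)) 0                      ≈⟨ ℚᵘ.*≡* (cong (ℤ._* ℤ.+ 1) pos-+) ⟩
  ℚᵘ.mkℚᵘ (ℤ.+ a) 0 ℚᵘ.+ ℚᵘ.mkℚᵘ (ℤ.+ b) 0      ≡⟨ cong₂ ℚᵘ._+_ (toℚᵘ-ℕtoℚ a) (toℚᵘ-ℕtoℚ b) ⟨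
  ℚ.toℚᵘ (ℕtoℚ a) ℚᵘ.+ ℚ.toℚᵘ (ℕtoℚ b)         ≈⟨ ℚ.toℚᵘ-homo-+ (ℕtoℚ a) (ℕtoℚ b) ⟨
  ℚ.toℚᵘ (ℕtoℚ a ℚ.+ ℕtoℚ b)                   ∎)
  where
  open ℚᵘ.≃-Reasoning
  pos-+ : ℤ.+ (a + b) ≡ ℤ.+ a ℤ.* ℤ.+ 1 ℤ.+ ℤ.+ b ℤ.* ℤ.+ 1
  pos-+ = trans (ℤ.pos-+ a b) (sym (cong₂ ℤ._+_ (ℤ.*-identityʳ (ℤ.+ a)) (ℤ.*-identityʳ (ℤ.+ b))))

ℕtoℚ-* : ∀ a b → ℕtoℚ (a * b) ≡ ℕtoℚ a ℚ.* ℕtoℚ b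
ℕtoℚ-* a b = ℚ.toℚᵘ-injective (begin
  ℚ.toℚᵘ (ℕtoℚ (a * b))                        ≡⟨ toℚᵘ-ℕtoℚ (a * b) ⟩
  ℚᵘ.mkℚᵘ (ℤ.+ (a * b)) 0                      ≈⟨ ℚᵘ.*≡* (cong (ℤ._* ℤ.+ 1) (ℤ.pos-* a b)) ⟩
  ℚᵘ.mkℚᵘ (ℤ.+ a) 0 ℚᵘ.* ℚᵘ.mkℚᵘ (ℤ.+ b) 0      ≡⟨ cong₂ ℚᵘ._*_ (toℚᵘ-ℕtoℚ a) (toℚᵘ-ℕtoℚ b) ⟨
  ℚ.toℚᵘ (ℕtoℚ a) ℚᵘ.* ℚ.toℚᵘ (ℕtoℚ b)         ≈⟨ ℚ.toℚᵘ-homo-* (ℕtoℚ a) (ℕtoℚ b) ⟨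
  ℚ.toℚᵘ (ℕtoℚ a ℚ.* ℕtoℚ b)                   ∎)
  where open ℚᵘ.≃-Reasoning

ℕtoℚ-mono-≤ : ∀ {a b} → a ≤ b → ℕtoℚ a ℚ.≤ ℕtoℚ b
ℕtoℚ-mono-≤ {a} {b} a≤b = ℚ.toℚᵘ-cancel-≤ (subst₂ ℚᵘ._≤_ (sym (toℚᵘ-ℕtoℚ a)) (sym (toℚᵘ-ℕtoℚ b))
  (ℚᵘ.*≤* (ℤ.*-monoʳ-≤-nonNeg (ℤ.+ 1) (ℤ.+≤+ a≤b))))

ℕtoℚ-mono-< : ∀ {a b} → a < b → ℕtoℚ a ℚ.< ℕtoℚ b
ℕtoℚ-mono-< {a} {b} a<b = ℚ.toℚᵘ-cancel-< (subst₂ ℚᵘ._<_ (sym (toℚᵘ-ℕtoℚ a)) (sym (toℚᵘ-ℕtoℚ b))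
  (ℚᵘ.*<* (ℤ.*-monoʳ-<-pos (ℤ.+ 1) (ℤ.+<+ a<b))))

ℕtoℚ-nonNeg : ∀ k → 0ℚ ℚ.≤ ℕtoℚ k
ℕtoℚ-nonNeg k = ℕtoℚ-mono-≤ {0} {k} ℕ.z≤n

ℕtoℚ-nonZero : ∀ q .{{_ : NonZero q}} → ℚ.NonZero (ℕtoℚ q)
ℕtoℚ-nonZero q = ℚ.pos⇒nonZero (ℕtoℚ q) {{ℚ.normalize-pos q 1}}

ℕtoℚ-positive : ∀ q .{{_ : NonZero q}} → ℚ.Positive (ℕtoℚ q)
ℕtoℚ-positive q = ℚ.normalize-pos q 1

*-cancelʳ-≤-ℕ : ∀ k .{{_ : NonZero k}} {x y} → x ℚ.* ℕtoℚ k ℚ.≤ y ℚ.* ℕtoℚ k → x ℚ.≤ y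
*-cancelʳ-≤-ℕ k = ℚ.*-cancelʳ-≤-pos (ℕtoℚ k) {{ℕtoℚ-positive k}}

infixl 7 _÷_
_÷_ : ℕ → (q : ℕ) → .{{NonZero q}} → ℚ
p ÷ q = (ℕtoℚ p ℚ.÷ ℕtoℚ q) {{ℕtoℚ-nonZero q}}

÷-*-cancel : ∀ p q .{{_ : NonZero q}} → p ÷ q ℚ.* ℕtoℚ q ≡ ℕtoℚ p
÷-*-cancel p q = begin
  ℕtoℚ p ℚ.* ℚ.1/ ℕtoℚ q ℚ.* ℕtoℚ q    ≡⟨ ℚ.*-assoc (ℕtoℚ p) _ _ ⟩
  ℕtoℚ p ℚ.* (ℚ.1/ ℕtoℚ q ℚ.* ℕtoℚ q)  ≡⟨ cong (ℕtoℚ p ℚ.*_) (ℚ.*-inverseˡ (ℕtoℚ q)) ⟩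
  ℕtoℚ p ℚ.* 1ℚ                        ≡⟨ ℚ.*-identityʳ (ℕtoℚ p) ⟩
  ℕtoℚ p                               ∎
  where
  open ≡-Reasoning
  instance
    q≢0 : ℚ.NonZero (ℕtoℚ q)
    q≢0 = ℕtoℚ-nonZero q

÷-scale : ∀ p q r .{{_ : NonZero q}} → p ÷ q ℚ.* ℕtoℚ (q * r) ≡ ℕtoℚ (p * r)
÷-scale p q r = begin
  p ÷ q ℚ.* ℕtoℚ (q * r)         ≡⟨ cong (p ÷ q ℚ.*_) (ℕtoℚ-* q r) ⟩
  p ÷ q ℚ.* (ℕtoℚ q ℚ.* ℕtoℚ r)  ≡⟨ ℚ.*-assoc (p ÷ q) _ _ ⟨
  p ÷ q ℚ.* ℕtoℚ q ℚ.* ℕtoℚ r    ≡⟨ cong (ℚ._* ℕtoℚ r) (÷-*-cancel p q) ⟩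
  ℕtoℚ p ℚ.* ℕtoℚ r              ≡⟨ ℕtoℚ-* p r ⟨
  ℕtoℚ (p * r)                   ∎
  where open ≡-Reasoning

÷-scale-comm : ∀ p q r .{{_ : NonZero q}} → p ÷ q ℚ.* ℕtoℚ (r * q) ≡ ℕtoℚ (p * r)
÷-scale-comm p q r = trans (cong (λ k → p ÷ q ℚ.* ℕtoℚ k) (ℕ.*-comm r q)) (÷-scale p q r)

÷-mono-≤ : ∀ p q p' q' .{{_ : NonZero q}} .{{_ : NonZero q'}} →
           p * q' ≤ p' * q → p ÷ q ℚ.≤ p' ÷ q'
÷-mono-≤ p q p' q' pq'≤p'q = *-cancelʳ-≤-ℕ (q * q') {{ℕ.m*n≢0 q q'}} (begin
  p ÷ q ℚ.* ℕtoℚ (q * q')    ≡⟨ ÷-scale p q q' ⟩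
  ℕtoℚ (p * q')              ≤⟨ ℕtoℚ-mono-≤ pq'≤p'q ⟩
  ℕtoℚ (p' * q)              ≡⟨ ÷-scale-comm p' q' q ⟨
  p' ÷ q' ℚ.* ℕtoℚ (q * q')  ∎)
  where open ℚ.≤-Reasoning

÷-mono-< : ∀ p q p' q' .{{_ : NonZero q}} .{{_ : NonZero q'}} →
           p * q' < p' * q → p ÷ q ℚ.< p' ÷ q'
÷-mono-< p q p' q' pq'<p'q =
  ℚ.*-cancelʳ-<-nonNeg (ℕtoℚ (q * q')) {{ℚ.nonNegative (ℕtoℚ-nonNeg (q * q'))}} (begin-strict
  p ÷ q ℚ.* ℕtoℚ (q * q')    ≡⟨ ÷-scale p q q' ⟩
  ℕtoℚ (p * q')              <⟨ ℕtoℚ-mono-< pq'<p'q ⟩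
  ℕtoℚ (p' * q)              ≡⟨ ÷-scale-comm p' q' q ⟨
  p' ÷ q' ℚ.* ℕtoℚ (q * q')  ∎)
  where open ℚ.≤-Reasoning

÷-nonNeg : ∀ p q .{{_ : NonZero q}} → 0ℚ ℚ.≤ p ÷ q
÷-nonNeg p q = ÷-mono-≤ 0 1 p q ℕ.z≤n  -- 0 ÷ 1 computes to 0ℚ

÷-square-scale : ∀ p q r .{{_ : NonZero q}} →
                 p ÷ q ℚ.* (p ÷ q) ℚ.* ℕtoℚ r ℚ.* ℕtoℚ (q * q) ≡ ℕtoℚ (p * p * r)
÷-square-scale p q r = begin
  x ℚ.* x ℚ.* R ℚ.* ℕtoℚ (q * q)          ≡⟨ cong (x ℚ.* x ℚ.* R ℚ.*_) (ℕtoℚ-* q q) ⟩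
  x ℚ.* x ℚ.* R ℚ.* (Q ℚ.* Q)             ≡⟨ rearrange x R Q ⟩
  x ℚ.* Q ℚ.* (x ℚ.* Q) ℚ.* R             ≡⟨ cong (λ y → y ℚ.* y ℚ.* R) (÷-*-cancel p q) ⟩
  ℕtoℚ p ℚ.* ℕtoℚ p ℚ.* R                 ≡⟨ cong (ℚ._* R) (ℕtoℚ-* p p) ⟨
  ℕtoℚ (p * p) ℚ.* R                      ≡⟨ ℕtoℚ-* (p * p) r ⟨
  ℕtoℚ (p * p * r)                        ∎
  where
  open ≡-Reasoning
  open ℚ-Solver
  x Q R : ℚ
  x = p ÷ q
  Q = ℕtoℚ q
  R = ℕtoℚ r
  rearrange : ∀ x R Q → x ℚ.* x ℚ.* R ℚ.* (Q ℚ.* Q) ≡ x ℚ.* Q ℚ.* (x ℚ.* Q) ℚ.* R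
  rearrange = solve 3 (λ x R Q → x :* x :* R :* (Q :* Q) := x :* Q :* (x :* Q) :* R) refl

÷-distribʳ-+ : ∀ p p' q .{{_ : NonZero q}} → (p + p') ÷ q ≡ p ÷ q ℚ.+ p' ÷ q
÷-distribʳ-+ p p' q = trans (cong (ℚ._* _) (ℕtoℚ-+ p p')) (ℚ.*-distribʳ-+ _ (ℕtoℚ p) (ℕtoℚ p'))

sumℚ-map-÷ : ∀ {A : Set} (f : A → ℕ) q .{{_ : NonZero q}} xs →
             sumℚ (map (λ x → f x ÷ q) xs) ≡ sum (map f xs) ÷ q
sumℚ-map-÷ f q []       = sym (ℚ.*-zeroˡ ((ℚ.1/ ℕtoℚ q) {{ℕtoℚ-nonZero q}}))
sumℚ-map-÷ f q (x ∷ xs) =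
  trans (cong (f x ÷ q ℚ.+_) (sumℚ-map-÷ f q xs)) (sym (÷-distribʳ-+ (f x) (sum (map f xs)) q))

-- Without this, approximations of a radicand need not be ordered: for (p , 0) every s ≥ 0 is a LowerApprox.
PositiveDenominator : Radicand → Set
PositiveDenominator = NonZero ∘ proj₂

square-cancel-≤ : ∀ {x y} → 0ℚ ℚ.≤ y → x ℚ.* x ℚ.≤ y ℚ.* y → x ℚ.≤ y
square-cancel-≤ {x} {y} 0≤y x²≤y² = ℚ.≮⇒≥ λ y<x → ℚ.<-irrefl refl (ℚ.<-≤-trans (y²<x² y<x) x²≤y²)
  where
  y²<x² : y ℚ.< x → y ℚ.* y ℚ.< x ℚ.* x
  y²<x² y<x = ℚ.≤-<-trans (ℚ.*-monoʳ-≤-nonNeg y {{ℚ.nonNegative 0≤y}} (ℚ.<⇒≤ y<x))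
                          (ℚ.*-monoʳ-<-pos x {{ℚ.positive (ℚ.≤-<-trans 0≤y y<x)}} y<x)

lowerApprox≤upperApprox : ∀ {s u} r .{{_ : PositiveDenominator r}} →
                          LowerApprox s r → UpperApprox u r → s ℚ.≤ u
lowerApprox≤upperApprox (p , q) (_ , s²q≤p) (0≤u , p≤u²q) =
  square-cancel-≤ 0≤u (*-cancelʳ-≤-ℕ q (ℚ.≤-trans s²q≤p p≤u²q))

lower≤upper : ∀ {xs ss us} → All PositiveDenominator xs →
              Pointwise LowerApprox ss xs → Pointwise UpperApprox us xs → Pointwise ℚ._≤_ ss us
lower≤upper               []         []       []       = []
lower≤upper {xs = r ∷ _} (nz ∷ nzs) (l ∷ ls) (u ∷ us) =
  lowerApprox≤upperApprox r {{nz}} l u ∷ lower≤upper nzs ls us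

sumℚ-mono-≤ : ∀ {xs ys} → Pointwise ℚ._≤_ xs ys → sumℚ xs ℚ.≤ sumℚ ys
sumℚ-mono-≤ []            = ℚ.≤-refl
sumℚ-mono-≤ (x≤y ∷ xs≤ys) = ℚ.+-mono-≤ x≤y (sumℚ-mono-≤ xs≤ys)

pointwise-map : ∀ {A C D : Set} {R : C → D → Set} (f : A → C) (g : A → D) {xs} →
                All (λ x → R (f x) (g x)) xs → Pointwise R (map f xs) (map g xs)
pointwise-map         f g []       = []
pointwise-map {R = R} f g (r ∷ rs) = r ∷ pointwise-map {R = R} f g rs

sumℚ-map-mono-≤ : ∀ {A : Set} {f g : A → ℚ} → (∀ x → f x ℚ.≤ g x) → ∀ xs →
                  sumℚ (map f xs) ℚ.≤ sumℚ (map g xs)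
sumℚ-map-mono-≤ {f = f} {g} f≤g xs = sumℚ-mono-≤ (pointwise-map {R = ℚ._≤_} f g (All.universal f≤g xs))

sumℚ-map-mono-< : ∀ {A : Set} {f g : A → ℚ} {x xs} → (∀ x → f x ℚ.≤ g x) → x ∈ xs → f x ℚ.< g x →
                  sumℚ (map f xs) ℚ.< sumℚ (map g xs)
sumℚ-map-mono-< {xs = _ ∷ xs} f≤g (here refl) fx<gx = ℚ.+-mono-<-≤ fx<gx (sumℚ-map-mono-≤ f≤g xs)
sumℚ-map-mono-< {xs = y ∷ _}  f≤g (there x∈xs) fx<gx = ℚ.+-mono-≤-< (f≤g y) (sumℚ-map-mono-< f≤g x∈xs fx<gx)

≤√-intro : ∀ {xs ys} us ls → All PositiveDenominator xs → All PositiveDenominator ys →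
           Pointwise UpperApprox us xs → Pointwise LowerApprox ls ys → sumℚ us ℚ.≤ sumℚ ls →
           xs ≤√ ys
≤√-intro us ls xs-nz ys-nz us-up ls-low Σus≤Σls ss vs ss-low vs-up = begin
  sumℚ ss  ≤⟨ sumℚ-mono-≤ (lower≤upper xs-nz ss-low us-up) ⟩
  sumℚ us  ≤⟨ Σus≤Σls ⟩
  sumℚ ls  ≤⟨ sumℚ-mono-≤ (lower≤upper ys-nz ls-low vs-up) ⟩
  sumℚ vs  ∎
  where open ℚ.≤-Reasoning

upperApprox-÷ : ∀ p q p' q' .{{_ : NonZero q'}} →
                p * (q' * q') ≤ p' * p' * q → UpperApprox (p' ÷ q') (p , q)
upperApprox-÷ p q p' q' h = ÷-nonNeg p' q' , *-cancelʳ-≤-ℕ (q' * q') {{ℕ.m*n≢0 q' q'}} (begin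
  ℕtoℚ p ℚ.* ℕtoℚ (q' * q')                          ≡⟨ ℕtoℚ-* p (q' * q') ⟨
  ℕtoℚ (p * (q' * q'))                               ≤⟨ ℕtoℚ-mono-≤ h ⟩
  ℕtoℚ (p' * p' * q)                                 ≡⟨ ÷-square-scale p' q' q ⟨
  p' ÷ q' ℚ.* (p' ÷ q') ℚ.* ℕtoℚ q ℚ.* ℕtoℚ (q' * q') ∎)
  where open ℚ.≤-Reasoning

lowerApprox-÷ : ∀ p q p' q' .{{_ : NonZero q'}} →
                p' * p' * q ≤ p * (q' * q') → LowerApprox (p' ÷ q') (p , q)
lowerApprox-÷ p q p' q' h = ÷-nonNeg p' q' , *-cancelʳ-≤-ℕ (q' * q') {{ℕ.m*n≢0 q' q'}} (begin
  p' ÷ q' ℚ.* (p' ÷ q') ℚ.* ℕtoℚ q ℚ.* ℕtoℚ (q' * q') ≡⟨ ÷-square-scale p' q' q ⟩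
  ℕtoℚ (p' * p' * q)                                 ≤⟨ ℕtoℚ-mono-≤ h ⟩
  ℕtoℚ (p * (q' * q'))                               ≡⟨ ℕtoℚ-* p (q' * q') ⟩
  ℕtoℚ p ℚ.* ℕtoℚ (q' * q')                          ∎)
  where open ℚ.≤-Reasoning

am-gm-ordered : ∀ {a b} → a ≤ b → 4 * a * b ≤ (a + b) * (a + b)
am-gm-ordered {a} a≤b with ℕ.m≤n⇒∃[o]m+o≡n a≤b
... | k , refl = ℕ.≤-trans (ℕ.m≤m+n _ (k * k)) (ℕ.≤-reflexive (square-expansion a k))
  where
  open ℕ-Solver
  square-expansion : ∀ a k → 4 * a * (a + k) + k * k ≡ (a + (a + k)) * (a + (a + k))
  square-expansion = solve 2 (λ a k → con 4 :* a :* (a :+ k) :+ k :* k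
                                      := (a :+ (a :+ k)) :* (a :+ (a :+ k))) refl

am-gm : ∀ a b → 4 * a * b ≤ (a + b) * (a + b)
am-gm a b with ℕ.≤-total a b
... | inj₁ a≤b = am-gm-ordered a≤b
... | inj₂ b≤a = subst₂ _≤_ (swap a b) (cong (λ s → s * s) (ℕ.+-comm b a)) (am-gm-ordered b≤a)
  where
  open ℕ-Solver
  swap : ∀ a b → 4 * b * a ≡ 4 * a * b
  swap = solve 2 (λ a b → con 4 :* b :* a := con 4 :* a :* b) refl

private
  harmonic-mean-expansion : ∀ δ a b → (a + b) * (2 * δ) ≡ 2 * (δ * a + δ * b)
  harmonic-mean-expansion = solve 3 (λ δ a b → (a :+ b) :* (con 2 :* δ) := con 2 :* (δ :* a :+ δ :* b)) refl
    where open ℕ-Solver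

  four-product-expansion : ∀ a b → 4 * a * b ≡ 2 * (b * a + a * b)
  four-product-expansion = solve 2 (λ a b → con 4 :* a :* b := con 2 :* (b :* a :+ a :* b)) refl
    where open ℕ-Solver

δ≤harmonic-mean : ∀ {δ a b} → δ ≤ a → δ ≤ b → (a + b) * (2 * δ) ≤ 4 * a * b
δ≤harmonic-mean {δ} {a} {b} δ≤a δ≤b = begin
  (a + b) * (2 * δ)    ≡⟨ harmonic-mean-expansion δ a b ⟩
  2 * (δ * a + δ * b)  ≤⟨ ℕ.*-monoʳ-≤ 2 (ℕ.+-mono-≤ (ℕ.*-monoˡ-≤ a δ≤b) (ℕ.*-monoˡ-≤ b δ≤a)) ⟩
  2 * (b * a + a * b)  ≡⟨ four-product-expansion a b ⟨
  4 * a * b            ∎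
  where open ℕ.≤-Reasoning

δ<harmonic-mean : ∀ {δ a b} .{{_ : NonZero a}} .{{_ : NonZero b}} → δ ≤ a → δ ≤ b → δ < a ⊎ δ < b →
                  (a + b) * (2 * δ) < 4 * a * b
δ<harmonic-mean {δ} {a} {b} δ≤a δ≤b δ<a⊎δ<b = begin-strict
  (a + b) * (2 * δ)    ≡⟨ harmonic-mean-expansion δ a b ⟩
  2 * (δ * a + δ * b)  <⟨ ℕ.*-monoʳ-< 2 (cross-terms-< δ<a⊎δ<b) ⟩
  2 * (b * a + a * b)  ≡⟨ four-product-expansion a b ⟨
  4 * a * b            ∎
  where
  open ℕ.≤-Reasoning
  cross-terms-< : δ < a ⊎ δ < b → δ * a + δ * b < b * a + a * b
  cross-terms-< (inj₁ δ<a) = ℕ.+-mono-≤-< (ℕ.*-monoˡ-≤ a δ≤b) (ℕ.*-monoˡ-< b δ<a)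
  cross-terms-< (inj₂ δ<b) = ℕ.+-mono-<-≤ (ℕ.*-monoˡ-< a δ<b) (ℕ.*-monoˡ-≤ b δ≤a)

agTerm : ℕ → ℕ → Radicand
agTerm a b = ((a + b) * (a + b) , 4 * a * b)

module AGEstimate {E : Set} (α β : E → ℕ) (δ : ℕ) .{{_ : NonZero δ}}
                  (δ≤α : ∀ e → δ ≤ α e) (δ≤β : ∀ e → δ ≤ β e) (es : List E) where

  private
    σ : E → ℕ
    σ e = α e + β e

    instance
      α≢0 : ∀ {e} → NonZero (α e)
      α≢0 {e} = ℕ.>-nonZero (ℕ.<-≤-trans (ℕ.>-nonZero⁻¹ δ) (δ≤α e))
      β≢0 : ∀ {e} → NonZero (β e)
      β≢0 {e} = ℕ.>-nonZero (ℕ.<-≤-trans (ℕ.>-nonZero⁻¹ δ) (δ≤β e))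
      σ≢0 : ∀ {e} → NonZero (σ e)
      σ≢0 {e} = ℕ.>-nonZero (ℕ.<-≤-trans (ℕ.>-nonZero⁻¹ (α e)) (ℕ.m≤m+n (α e) (β e)))
      4αβ≢0 : ∀ {e} → NonZero (4 * α e * β e)
      4αβ≢0 {e} = ℕ.m*n≢0 (4 * α e) (β e) {{ℕ.m*n≢0 4 (α e)}}
      2δ≢0 : NonZero (2 * δ)
      2δ≢0 = ℕ.m*n≢0 2 δ

    4δδ≡2δ*2δ : 4 * δ * δ ≡ 2 * δ * (2 * δ)
    4δδ≡2δ*2δ = solve 1 (λ δ → con 4 :* δ :* δ := con 2 :* δ :* (con 2 :* δ)) refl δ
      where open ℕ-Solver

  terms : SqrtSum
  terms = map (λ e → agTerm (α e) (β e)) es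

  bound : ℕ → SqrtSum
  bound N = (N , 4 * δ * δ) ∷ []

  M₁ : ℕ
  M₁ = sum (map σ es)

  termSquare : E → ℚ
  termSquare e = σ e * σ e ÷ (4 * α e * β e)

  termBound : E → ℚ
  termBound e = σ e ÷ (2 * δ)

  -- The term t = σ/(2√(αβ)) is at least 1 (AM-GM), hence t ≤ t² = termSquare.
  termSquare-upperApprox : ∀ e → UpperApprox (termSquare e) (agTerm (α e) (β e))
  termSquare-upperApprox e = upperApprox-÷ S Q S Q (begin
    S * (Q * Q)  ≡⟨ ℕ.*-assoc S Q Q ⟨
    S * Q * Q    ≤⟨ ℕ.*-monoʳ-≤ (S * Q) (am-gm (α e) (β e)) ⟩
    S * Q * S    ≡⟨ ℕ.*-assoc S Q S ⟩
    S * (Q * S)  ≡⟨ cong (S *_) (ℕ.*-comm Q S) ⟩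
    S * (S * Q)  ≡⟨ ℕ.*-assoc S S Q ⟨
    S * S * Q    ∎)
    where
    open ℕ.≤-Reasoning
    S Q : ℕ
    S = σ e * σ e
    Q = 4 * α e * β e

  termSquare≤termBound : ∀ e → termSquare e ℚ.≤ termBound e
  termSquare≤termBound e = ÷-mono-≤ (σ e * σ e) (4 * α e * β e) (σ e) (2 * δ) (begin
    σ e * σ e * (2 * δ)    ≡⟨ ℕ.*-assoc (σ e) (σ e) (2 * δ) ⟩
    σ e * (σ e * (2 * δ))  ≤⟨ ℕ.*-monoʳ-≤ (σ e) (δ≤harmonic-mean (δ≤α e) (δ≤β e)) ⟩
    σ e * (4 * α e * β e)  ∎)
    where open ℕ.≤-Reasoning

  termSquare<termBound : ∀ e → δ < α e ⊎ δ < β e → termSquare e ℚ.< termBound e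
  termSquare<termBound e δ<α⊎δ<β = ÷-mono-< (σ e * σ e) (4 * α e * β e) (σ e) (2 * δ) (begin-strict
    σ e * σ e * (2 * δ)    ≡⟨ ℕ.*-assoc (σ e) (σ e) (2 * δ) ⟩
    σ e * (σ e * (2 * δ))  <⟨ ℕ.*-monoʳ-< (σ e) (δ<harmonic-mean (δ≤α e) (δ≤β e) δ<α⊎δ<β) ⟩
    σ e * (4 * α e * β e)  ∎)
    where open ℕ.≤-Reasoning

  termBound-lowerApprox : ∀ e → α e ≡ δ → β e ≡ δ → LowerApprox (termBound e) (agTerm (α e) (β e))
  termBound-lowerApprox e αe≡δ βe≡δ = lowerApprox-÷ (σ e * σ e) (4 * α e * β e) (σ e) (2 * δ)
    (ℕ.≤-reflexive (cong (σ e * σ e *_) (trans (cong₂ (λ a b → 4 * a * b) αe≡δ βe≡δ) 4δδ≡2δ*2δ)))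

  sumℚ-termBound : sumℚ (map termBound es) ≡ M₁ ÷ (2 * δ)
  sumℚ-termBound = sumℚ-map-÷ σ (2 * δ) es

  M₁-lowerApprox : ∀ N → M₁ * M₁ ≤ N → LowerApprox (M₁ ÷ (2 * δ)) (N , 4 * δ * δ)
  M₁-lowerApprox N M₁²≤N = lowerApprox-÷ N (4 * δ * δ) M₁ (2 * δ) (begin
    M₁ * M₁ * (4 * δ * δ)        ≡⟨ cong (M₁ * M₁ *_) 4δδ≡2δ*2δ ⟩
    M₁ * M₁ * (2 * δ * (2 * δ))  ≤⟨ ℕ.*-monoˡ-≤ (2 * δ * (2 * δ)) M₁²≤N ⟩
    N * (2 * δ * (2 * δ))        ∎)
    where open ℕ.≤-Reasoning

  M₁-upperApprox : ∀ N → N ≤ M₁ * M₁ → UpperApprox (M₁ ÷ (2 * δ)) (N , 4 * δ * δ)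
  M₁-upperApprox N N≤M₁² = upperApprox-÷ N (4 * δ * δ) M₁ (2 * δ) (begin
    N * (2 * δ * (2 * δ))        ≤⟨ ℕ.*-monoˡ-≤ (2 * δ * (2 * δ)) N≤M₁² ⟩
    M₁ * M₁ * (2 * δ * (2 * δ))  ≡⟨ cong (M₁ * M₁ *_) 4δδ≡2δ*2δ ⟨
    M₁ * M₁ * (4 * δ * δ)        ∎)
    where open ℕ.≤-Reasoning

  terms-positive : All PositiveDenominator terms
  terms-positive = All.map⁺ (All.universal (λ _ → 4αβ≢0) es)

  bound-positive : ∀ N → All PositiveDenominator (bound N)
  bound-positive N = ℕ.m*n≢0 (4 * δ) δ {{ℕ.m*n≢0 4 δ}} ∷ []

  termSquares-upperApprox : Pointwise UpperApprox (map termSquare es) terms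
  termSquares-upperApprox =
    pointwise-map {R = UpperApprox} termSquare _ (All.universal termSquare-upperApprox es)

  terms≤bound : ∀ N → M₁ * M₁ ≤ N → terms ≤√ bound N
  terms≤bound N M₁²≤N = ≤√-intro (map termSquare es) (M₁ ÷ (2 * δ) ∷ [])
    terms-positive (bound-positive N) termSquares-upperApprox (M₁-lowerApprox N M₁²≤N ∷ []) (begin
      sumℚ (map termSquare es)  ≤⟨ sumℚ-map-mono-≤ termSquare≤termBound es ⟩
      sumℚ (map termBound es)   ≡⟨ sumℚ-termBound ⟩
      M₁ ÷ (2 * δ)              ≡⟨ ℚ.+-identityʳ _ ⟨
      M₁ ÷ (2 * δ) ℚ.+ 0ℚ       ∎)
    where open ℚ.≤-Reasoning

  AllEqualδ : Set
  AllEqualδ = ∀ {e} → e ∈ es → α e ≡ δ × β e ≡ δ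

  bound≤terms⇒allEqualδ : ∀ N → M₁ * M₁ ≤ N → bound N ≤√ terms → AllEqualδ
  bound≤terms⇒allEqualδ N M₁²≤N bound≤terms {e} e∈es =
    ℕ.≤-antisym (ℕ.≮⇒≥ (not-strict ∘ inj₁)) (δ≤α e) , ℕ.≤-antisym (ℕ.≮⇒≥ (not-strict ∘ inj₂)) (δ≤β e)
    where
    open ℚ.≤-Reasoning
    not-strict : δ < α e ⊎ δ < β e → ⊥
    not-strict δ<α⊎δ<β = ℚ.<-irrefl refl (begin-strict
      M₁ ÷ (2 * δ)              ≡⟨ ℚ.+-identityʳ _ ⟨
      M₁ ÷ (2 * δ) ℚ.+ 0ℚ       ≤⟨ bound≤terms _ _ (M₁-lowerApprox N M₁²≤N ∷ []) termSquares-upperApprox ⟩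
      sumℚ (map termSquare es)  <⟨ sumℚ-map-mono-< termSquare≤termBound e∈es (termSquare<termBound e δ<α⊎δ<β) ⟩
      sumℚ (map termBound es)   ≡⟨ sumℚ-termBound ⟩
      M₁ ÷ (2 * δ)              ∎)

  allEqualδ⇒bound≤terms : ∀ N → AllEqualδ → N ≤ M₁ * M₁ → bound N ≤√ terms
  allEqualδ⇒bound≤terms N allEqualδ N≤M₁² = ≤√-intro (M₁ ÷ (2 * δ) ∷ []) (map termBound es)
    (bound-positive N) terms-positive (M₁-upperApprox N N≤M₁² ∷ []) termBounds-lowerApprox
    (ℚ.≤-reflexive (trans (ℚ.+-identityʳ _) (sym sumℚ-termBound)))
    where
    termBounds-lowerApprox : Pointwise LowerApprox (map termBound es) terms
    termBounds-lowerApprox = pointwise-map {R = LowerApprox} termBound _ (All.tabulate λ e∈es →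
      termBound-lowerApprox _ (proj₁ (allEqualδ e∈es)) (proj₂ (allEqualδ e∈es)))

sum-map-+ : ∀ {A : Set} (f g : A → ℕ) xs →
            sum (map (λ x → f x + g x) xs) ≡ sum (map f xs) + sum (map g xs)
sum-map-+ f g []       = refl
sum-map-+ f g (x ∷ xs) = trans (cong (f x + g x +_) (sum-map-+ f g xs)) (interchange (f x) (g x) _ _)

sum-map-const : ∀ {A : Set} {f : A → ℕ} {k} → (∀ x → f x ≡ k) → ∀ xs → sum (map f xs) ≡ length xs * k
sum-map-const f≡k []       = refl
sum-map-const f≡k (x ∷ xs) = cong₂ _+_ (f≡k x) (sum-map-const f≡k xs)

sum-map-filterᵇ : ∀ {A : Set} (p : A → Bool) (f : A → ℕ) xs →
                  sum (map f (filterᵇ p xs)) ≡ sum (map (λ x → if p x then f x else 0) xs)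
sum-map-filterᵇ p f []       = refl
sum-map-filterᵇ p f (x ∷ xs) with p x
... | true  = cong (f x +_) (sum-map-filterᵇ p f xs)
... | false = sum-map-filterᵇ p f xs

sum-map-concatMap : ∀ {A B : Set} (g : A → List B) (f : B → ℕ) xs →
                    sum (map f (concatMap g xs)) ≡ sum (map (λ x → sum (map f (g x))) xs)
sum-map-concatMap g f []       = refl
sum-map-concatMap g f (x ∷ xs) = begin
  sum (map f (g x ++ concatMap g xs))                         ≡⟨ cong sum (List.map-++ f (g x) _) ⟩
  sum (map f (g x) ++ map f (concatMap g xs))                 ≡⟨ ListAction.sum-++ (map f (g x)) _ ⟩
  sum (map f (g x)) + sum (map f (concatMap g xs))            ≡⟨ cong (sum (map f (g x)) +_) IH ⟩
  sum (map f (g x)) + sum (map (λ x → sum (map f (g x))) xs)  ∎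
  where
  open ≡-Reasoning
  IH : sum (map f (concatMap g xs)) ≡ sum (map (λ x → sum (map f (g x))) xs)
  IH = sum-map-concatMap g f xs

sum-map-swap : ∀ {A B : Set} (f : A → B → ℕ) xs ys →
               sum (map (λ x → sum (map (f x) ys)) xs) ≡ sum (map (λ y → sum (map (λ x → f x y) xs)) ys)
sum-map-swap f []       ys = sym (trans (sum-map-const (λ _ → refl) ys) (ℕ.*-zeroʳ (length ys)))
sum-map-swap f (x ∷ xs) ys = trans (cong (sum (map (f x) ys) +_) (sum-map-swap f xs ys))
                                   (sym (sum-map-+ (f x) (λ y → sum (map (λ x → f x y) xs)) ys))

sum-map-≤ : ∀ {A : Set} {f : A → ℕ} {B} → (∀ x → f x ≤ B) → ∀ xs → sum (map f xs) ≤ length xs * B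
sum-map-≤ f≤B []       = ℕ.z≤n
sum-map-≤ f≤B (x ∷ xs) = ℕ.+-mono-≤ (f≤B x) (sum-map-≤ f≤B xs)

n+n*[n∸1]≡n*n : ∀ n → n + n * (n ∸ 1) ≡ n * n
n+n*[n∸1]≡n*n zero    = refl
n+n*[n∸1]≡n*n (suc n) = sym (ℕ.*-suc (suc n) n)

square-of-sum-≤ : ∀ {A : Set} {f : A → ℕ} {B} → (∀ x → f x ≤ B) → ∀ xs →
                  sum (map f xs) * sum (map f xs) ≤
                  sum (map (λ x → f x * f x) xs) + length xs * (length xs ∸ 1) * (B * B)
square-of-sum-≤             f≤B []       = ℕ.z≤n
square-of-sum-≤ {f = f} {B} f≤B (x ∷ xs) = begin
  (a + S) * (a + S)                                        ≡⟨ expand a S ⟩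
  a * a + S * S + 2 * (a * S)                              ≤⟨ ℕ.+-mono-≤ (ℕ.+-monoʳ-≤ (a * a) IH) cross-term ⟩
  a * a + (Q + ℓ * (ℓ ∸ 1) * (B * B)) + 2 * (B * (ℓ * B))  ≡⟨ collect (a * a) Q ℓ (ℓ * (ℓ ∸ 1)) B ⟩
  a * a + Q + (ℓ + ℓ * (ℓ ∸ 1) + ℓ) * (B * B)              ≡⟨ cong (λ k → a * a + Q + (k + ℓ) * (B * B))
                                                                   (n+n*[n∸1]≡n*n ℓ) ⟩
  a * a + Q + (ℓ * ℓ + ℓ) * (B * B)                        ≡⟨ cong (λ k → a * a + Q + k * (B * B))
                                                                   (ℕ.+-comm (ℓ * ℓ) ℓ) ⟩
  a * a + Q + suc ℓ * ℓ * (B * B)                          ∎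
  where
  open ℕ.≤-Reasoning
  open ℕ-Solver
  a S Q ℓ : ℕ
  a = f x
  S = sum (map f xs)
  Q = sum (map (λ x → f x * f x) xs)
  ℓ = length xs
  IH : S * S ≤ Q + ℓ * (ℓ ∸ 1) * (B * B)
  IH = square-of-sum-≤ f≤B xs
  cross-term : 2 * (a * S) ≤ 2 * (B * (ℓ * B))
  cross-term = ℕ.*-monoʳ-≤ 2 (ℕ.*-mono-≤ (f≤B x) (sum-map-≤ f≤B xs))
  expand : ∀ a S → (a + S) * (a + S) ≡ a * a + S * S + 2 * (a * S)
  expand = solve 2 (λ a S → (a :+ S) :* (a :+ S) := a :* a :+ S :* S :+ con 2 :* (a :* S)) refl
  collect : ∀ a² Q ℓ P B → a² + (Q + P * (B * B)) + 2 * (B * (ℓ * B)) ≡ a² + Q + (ℓ + P + ℓ) * (B * B)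
  collect = solve 5 (λ a² Q ℓ P B → a² :+ (Q :+ P :* (B :* B)) :+ con 2 :* (B :* (ℓ :* B))
                                    := a² :+ Q :+ (ℓ :+ P :+ ℓ) :* (B :* B)) refl

sum-map-*ˡ : ∀ {A : Set} k (f : A → ℕ) xs → sum (map (λ x → k * f x) xs) ≡ k * sum (map f xs)
sum-map-*ˡ k f []       = sym (ℕ.*-zeroʳ k)
sum-map-*ˡ k f (x ∷ xs) = trans (cong (k * f x +_) (sum-map-*ˡ k f xs)) (sym (ℕ.*-distribˡ-+ k (f x) _))

∈⇒length-nonZero : ∀ {A : Set} {x : A} {xs} → x ∈ xs → NonZero (length xs)
∈⇒length-nonZero (here _)  = _
∈⇒length-nonZero (there _) = _

Star-first-step : ∀ {A : Set} {R : A → A → Set} {i j} → Star R i j → i ≢ j → ∃ (R i)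
Star-first-step ε       i≢i = ⊥-elim (i≢i refl)
Star-first-step (r ◅ _) _   = _ , r

has-neighbour : ∀ {n} (G : Graph (suc (suc n))) → Connected G → ∀ i → ∃[ j ] T (adj G i j)
has-neighbour G connected fzero    = Star-first-step (connected fzero (fsuc fzero)) λ ()
has-neighbour G connected (fsuc i) = Star-first-step (connected (fsuc i) fzero) λ ()

module _ {n : ℕ} (G : Graph n) where

  private
    V : List (Fin n)
    V = allFin n

    Σᵥ : (Fin n → ℕ) → ℕ
    Σᵥ f = sum (map f V)

    Σᵥ-cong : ∀ {f g} → (∀ i → f i ≡ g i) → Σᵥ f ≡ Σᵥ g
    Σᵥ-cong f≗g = cong sum (List.map-cong f≗g V)

    row : Fin n → List (Fin n × Fin n)
    row i = map (λ j → (i , j)) V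

    oriented : Fin n × Fin n → Bool
    oriented e = adj G (proj₁ e) (proj₂ e) ∧ (toℕ (proj₁ e) <ᵇ toℕ (proj₂ e))

    onArc : Fin n → Fin n → ℕ → ℕ
    onArc i j x = if oriented (i , j) then x else 0

    d₁ d₂ σ : Fin n × Fin n → ℕ
    d₁ e = deg G (proj₁ e)
    d₂ e = deg G (proj₂ e)
    σ e = d₁ e + d₂ e

    sum-edges : ∀ h → sum (map h (edges G)) ≡ Σᵥ (λ i → Σᵥ (λ j → onArc i j (h (i , j))))
    sum-edges h = begin
      sum (map h (filterᵇ oriented (concatMap row V)))  ≡⟨ sum-map-filterᵇ oriented h (concatMap row V) ⟩
      sum (map h? (concatMap row V))                    ≡⟨ sum-map-concatMap row h? V ⟩
      Σᵥ (λ i → sum (map h? (row i)))                   ≡⟨ Σᵥ-cong (λ i → cong sum (List.map-∘ V)) ⟨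
      Σᵥ (λ i → Σᵥ (λ j → h? (i , j)))                  ∎
      where
      open ≡-Reasoning
      h? : Fin n × Fin n → ℕ
      h? e = if oriented e then h e else 0

    oriented-either-way : ∀ i j x → (if oriented (i , j) then x else 0) + (if oriented (j , i) then x else 0)
                                    ≡ (if adj G i j then x else 0)
    oriented-either-way i j x rewrite Graph.sym G j i with adj G i j in i~j
    ... | false = refl
    ... | true with toℕ i <ᵇ toℕ j | ℕ.<ᵇ-reflects-< (toℕ i) (toℕ j)
                  | toℕ j <ᵇ toℕ i | ℕ.<ᵇ-reflects-< (toℕ j) (toℕ i)
    ...   | true  | ofʸ i<j | true  | ofʸ j<i = ⊥-elim (ℕ.<-asym i<j j<i)
    ...   | true  | _       | false | _       = ℕ.+-identityʳ x
    ...   | false | _       | true  | _       = refl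
    ...   | false | ofⁿ i≮j | false | ofⁿ j≮i
      with refl ← Fin.toℕ-injective (ℕ.≤-antisym (ℕ.≮⇒≥ j≮i) (ℕ.≮⇒≥ i≮j))
      with () ← trans (sym i~j) (Graph.irrefl G i)

  handshake : ∀ g → sum (map (λ e → g (proj₁ e) + g (proj₂ e)) (edges G)) ≡
                    sum (map (λ i → deg G i * g i) (allFin n))
  handshake g = begin
    sum (map (λ e → g (proj₁ e) + g (proj₂ e)) (edges G))
      ≡⟨ sum-map-+ (g ∘ proj₁) (g ∘ proj₂) (edges G) ⟩
    sum (map (g ∘ proj₁) (edges G)) + sum (map (g ∘ proj₂) (edges G))
      ≡⟨ cong₂ _+_ (sum-edges (g ∘ proj₁)) (sum-edges (g ∘ proj₂)) ⟩
    Σᵥ (λ i → Σᵥ (λ j → onArc i j (g i))) + Σᵥ (λ i → Σᵥ (λ j → onArc i j (g j)))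
      ≡⟨ cong (Σᵥ (λ i → Σᵥ (λ j → onArc i j (g i))) +_) (sum-map-swap (λ i j → onArc i j (g j)) V V) ⟩
    Σᵥ (λ i → Σᵥ (λ j → onArc i j (g i))) + Σᵥ (λ i → Σᵥ (λ j → onArc j i (g i)))
      ≡⟨ sum-map-+ _ _ V ⟨
    Σᵥ (λ i → Σᵥ (λ j → onArc i j (g i)) + Σᵥ (λ j → onArc j i (g i)))
      ≡⟨ Σᵥ-cong (λ i → sum-map-+ (λ j → onArc i j (g i)) (λ j → onArc j i (g i)) V) ⟨
    Σᵥ (λ i → Σᵥ (λ j → onArc i j (g i) + onArc j i (g i)))
      ≡⟨ Σᵥ-cong (λ i → Σᵥ-cong (λ j → oriented-either-way i j (g i))) ⟩
    Σᵥ (λ i → Σᵥ (λ j → if adj G i j then g i else 0))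
      ≡⟨ Σᵥ-cong (λ i → sum-map-filterᵇ (adj G i) (λ _ → g i) V) ⟨
    Σᵥ (λ i → sum (map (λ _ → g i) (filterᵇ (adj G i) V)))
      ≡⟨ Σᵥ-cong (λ i → sum-map-const (λ _ → refl) (filterᵇ (adj G i) V)) ⟩
    Σᵥ (λ i → deg G i * g i)
      ∎
    where open ≡-Reasoning

  ∈-edges : ∀ {i j} → T (adj G i j) → toℕ i < toℕ j → (i , j) ∈ edges G
  ∈-edges {i} {j} i~j i<j = ∈-filter⁺ (T? ∘ oriented) (∈-concatMap⁺ row ij∈rows)
                                      (Equivalence.from T-∧ (i~j , ℕ.<⇒<ᵇ i<j))
    where
    ij∈rows : Any.Any (λ k → (i , j) ∈ row k) V
    ij∈rows = Any.map (λ { refl → ∈-map⁺ (λ k → (i , k)) (∈-allFin j) }) (∈-allFin i)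

  edge-endpoint : ∀ {P : Fin n → Set} → (∀ {e} → e ∈ edges G → P (proj₁ e) × P (proj₂ e)) →
                  ∀ {i j} → T (adj G i j) → P i
  edge-endpoint P-edges {i} {j} i~j with ℕ.<-cmp (toℕ i) (toℕ j)
  ... | tri< i<j _ _ = proj₁ (P-edges (∈-edges i~j i<j))
  ... | tri> _ _ j<i = proj₂ (P-edges (∈-edges (subst T (Graph.sym G i j) i~j) j<i))
  ... | tri≈ _ i≡j _ with refl ← Fin.toℕ-injective i≡j = ⊥-elim (subst T (Graph.irrefl G i) i~j)

  deg-nonZero : ∀ {i j} → T (adj G i j) → NonZero (deg G i)
  deg-nonZero {i} {j} i~j = ∈⇒length-nonZero (∈-filter⁺ (T? ∘ adj G i) (∈-allFin j) i~j)

  every-degree : ∀ {P : ℕ → Set} → All P (degrees G) → ∀ i → P (deg G i)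
  every-degree all i = All.lookup (All.map⁻ all) (∈-allFin i)

  all-degrees : ∀ {P : ℕ → Set} → (∀ i → P (deg G i)) → All P (degrees G)
  all-degrees P-deg = All.map⁺ (All.tabulate λ {i} _ → P-deg i)

  deg≤Δ : ∀ i → deg G i ≤ Δ G
  deg≤Δ = every-degree (List.foldr-forcesᵇ split 0 (degrees G) ℕ.≤-refl)
    where
    split : ∀ x y → x ℕ.⊔ y ≤ Δ G → x ≤ Δ G × y ≤ Δ G
    split x y x⊔y≤Δ = ℕ.m⊔n≤o⇒m≤o x y x⊔y≤Δ , ℕ.m⊔n≤o⇒n≤o x y x⊔y≤Δ

  δ≤deg : ∀ i → δ G ≤ deg G i
  δ≤deg = every-degree (List.foldr-forcesᵇ split (Δ G) (degrees G) ℕ.≤-refl)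
    where
    split : ∀ x y → δ G ≤ x ℕ.⊓ y → δ G ≤ x × δ G ≤ y
    split x y δ≤x⊓y = ℕ.m≤n⊓o⇒m≤n x y δ≤x⊓y , ℕ.m≤n⊓o⇒m≤o x y δ≤x⊓y

  Δ-least : ∀ {c} → (∀ i → deg G i ≤ c) → Δ G ≤ c
  Δ-least {c} deg≤c = List.foldr-preservesᵇ {P = _≤ c} {f = ℕ._⊔_} ℕ.⊔-lub ℕ.z≤n (all-degrees deg≤c)

  δ-greatest : ∀ {c} → c ≤ Δ G → (∀ i → c ≤ deg G i) → c ≤ δ G
  δ-greatest {c} c≤Δ c≤deg = List.foldr-preservesᵇ {P = c ≤_} {f = ℕ._⊓_} ℕ.⊓-glb c≤Δ (all-degrees c≤deg)

  δ-nonZero : Fin n → (∀ i → ∃[ j ] T (adj G i j)) → NonZero (δ G)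
  δ-nonZero i₀ neighbour = ℕ.>-nonZero (δ-greatest (ℕ.≤-trans (deg-positive i₀) (deg≤Δ i₀)) deg-positive)
    where
    deg-positive : ∀ i → 0 < deg G i
    deg-positive i = ℕ.>-nonZero⁻¹ (deg G i) {{deg-nonZero (proj₂ (neighbour i))}}

  regular⇒deg≡δ : Regular G → ∀ i → deg G i ≡ δ G
  regular⇒deg≡δ regular i = ℕ.≤-antisym (δ-greatest (deg≤Δ i) (ℕ.≤-reflexive ∘ regular i)) (δ≤deg i)

  M₁ : ℕ
  M₁ = sum (map σ (edges G))

  boundNumerator : ℕ
  boundNumerator = F G + 2 * M₂ G + 4 * m G * (m G ∸ 1) * (Δ G * Δ G)

  private
    F≡sum-edges : F G ≡ sum (map (λ e → d₁ e * d₁ e + d₂ e * d₂ e) (edges G))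
    F≡sum-edges = begin
      sum (map (λ d → d * d * d) (map (deg G) V))             ≡⟨ cong sum (List.map-∘ V) ⟨
      Σᵥ (λ i → deg G i * deg G i * deg G i)                  ≡⟨ Σᵥ-cong (λ i → ℕ.*-assoc (deg G i) _ _) ⟩
      Σᵥ (λ i → deg G i * (deg G i * deg G i))                ≡⟨ handshake (λ i → deg G i * deg G i) ⟨
      sum (map (λ e → d₁ e * d₁ e + d₂ e * d₂ e) (edges G))   ∎
      where open ≡-Reasoning

    sum-edges-σ²≡F+2M₂ : sum (map (λ e → σ e * σ e) (edges G)) ≡ F G + 2 * M₂ G
    sum-edges-σ²≡F+2M₂ = begin
      sum (map (λ e → σ e * σ e) (edges G))
        ≡⟨ cong sum (List.map-cong (λ e → expand (d₁ e) (d₂ e)) (edges G)) ⟩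
      sum (map (λ e → (d₁ e * d₁ e + d₂ e * d₂ e) + 2 * (d₁ e * d₂ e)) (edges G))
        ≡⟨ sum-map-+ _ (λ e → 2 * (d₁ e * d₂ e)) (edges G) ⟩
      sum (map (λ e → d₁ e * d₁ e + d₂ e * d₂ e) (edges G)) + sum (map (λ e → 2 * (d₁ e * d₂ e)) (edges G))
        ≡⟨ cong₂ _+_ F≡sum-edges (sym (sum-map-*ˡ 2 (λ e → d₁ e * d₂ e) (edges G))) ⟨
      F G + 2 * M₂ G
        ∎
      where
      open ≡-Reasoning
      open ℕ-Solver
      expand : ∀ a b → (a + b) * (a + b) ≡ (a * a + b * b) + 2 * (a * b)
      expand = solve 2 (λ a b → (a :+ b) :* (a :+ b) := (a :* a :+ b :* b) :+ con 2 :* (a :* b)) refl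

    boundNumerator≡ : boundNumerator ≡
                      sum (map (λ e → σ e * σ e) (edges G)) + m G * (m G ∸ 1) * ((Δ G + Δ G) * (Δ G + Δ G))
    boundNumerator≡ = cong₂ _+_ (sym sum-edges-σ²≡F+2M₂) (rearrange (m G) (m G ∸ 1) (Δ G))
      where
      open ℕ-Solver
      rearrange : ∀ m k Δ → 4 * m * k * (Δ * Δ) ≡ m * k * ((Δ + Δ) * (Δ + Δ))
      rearrange = solve 3 (λ m k Δ → con 4 :* m :* k :* (Δ :* Δ) := m :* k :* ((Δ :+ Δ) :* (Δ :+ Δ))) refl

  M₁²≤boundNumerator : M₁ * M₁ ≤ boundNumerator
  M₁²≤boundNumerator = ℕ.≤-trans (square-of-sum-≤ σ≤2Δ (edges G)) (ℕ.≤-reflexive (sym boundNumerator≡))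
    where
    σ≤2Δ : ∀ e → σ e ≤ Δ G + Δ G
    σ≤2Δ e = ℕ.+-mono-≤ (deg≤Δ (proj₁ e)) (deg≤Δ (proj₂ e))

  regular⇒boundNumerator≤M₁² : ∀ {c} → (∀ i → deg G i ≡ c) → boundNumerator ≤ M₁ * M₁
  regular⇒boundNumerator≤M₁² {c} deg≡c = begin
    boundNumerator                                                   ≡⟨ boundNumerator≡ ⟩
    sum (map (λ e → σ e * σ e) (edges G)) + ℓ * (ℓ ∸ 1) * (2Δ * 2Δ)  ≤⟨ ℕ.+-mono-≤ (ℕ.≤-reflexive Σσ²≡)
                                                                          (ℕ.*-monoʳ-≤ (ℓ * (ℓ ∸ 1)) 2Δ²≤2c²) ⟩
    ℓ * (2c * 2c) + ℓ * (ℓ ∸ 1) * (2c * 2c)                          ≡⟨ ℕ.*-distribʳ-+ (2c * 2c) ℓ _ ⟨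
    (ℓ + ℓ * (ℓ ∸ 1)) * (2c * 2c)                                    ≡⟨ cong (_* (2c * 2c)) (n+n*[n∸1]≡n*n ℓ) ⟩
    ℓ * ℓ * (2c * 2c)                                                ≡⟨ regroup ℓ 2c ⟩
    ℓ * 2c * (ℓ * 2c)                                                ≡⟨ cong (λ s → s * s) M₁≡ℓ*2c ⟨
    M₁ * M₁                                                          ∎
    where
    open ℕ.≤-Reasoning
    open ℕ-Solver
    ℓ 2Δ 2c : ℕ
    ℓ = m G
    2Δ = Δ G + Δ G
    2c = c + c
    σ≡2c : ∀ e → σ e ≡ 2c
    σ≡2c e = cong₂ _+_ (deg≡c (proj₁ e)) (deg≡c (proj₂ e))
    M₁≡ℓ*2c : M₁ ≡ ℓ * 2c
    M₁≡ℓ*2c = sum-map-const σ≡2c (edges G)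
    Σσ²≡ : sum (map (λ e → σ e * σ e) (edges G)) ≡ ℓ * (2c * 2c)
    Σσ²≡ = sum-map-const (λ e → cong (λ s → s * s) (σ≡2c e)) (edges G)
    2Δ²≤2c² : 2Δ * 2Δ ≤ 2c * 2c
    2Δ²≤2c² = ℕ.*-mono-≤ 2Δ≤2c 2Δ≤2c
      where
      2Δ≤2c : 2Δ ≤ 2c
      2Δ≤2c = ℕ.+-mono-≤ (Δ-least (ℕ.≤-reflexive ∘ deg≡c)) (Δ-least (ℕ.≤-reflexive ∘ deg≡c))
    regroup : ∀ ℓ s → ℓ * ℓ * (s * s) ≡ ℓ * s * (ℓ * s)
    regroup = solve 2 (λ ℓ s → ℓ :* ℓ :* (s :* s) := ℓ :* s :* (ℓ :* s)) refl

corollary2 : (n : ℕ) (G : Graph n) → 2 ≤ n → Connected G →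
    (AG G ≤√ AGBound G) × ((AG G ≈√ AGBound G) ⇔ Regular G)
corollary2 (suc (suc _)) G (ℕ.s≤s (ℕ.s≤s ℕ.z≤n)) connected =
  AG≤bound , mk⇔ (λ (_ , bound≤AG) → regular (bound≤terms⇒allEqualδ N (M₁²≤boundNumerator G) bound≤AG))
                 (λ reg → AG≤bound , allEqualδ⇒bound≤terms N (allEqualδ reg)
                                       (regular⇒boundNumerator≤M₁² G (regular⇒deg≡δ G reg)))
  where
  neighbour : ∀ i → ∃[ j ] T (adj G i j)
  neighbour = has-neighbour G connected

  instance
    δ≢0 : NonZero (δ G)
    δ≢0 = δ-nonZero G fzero neighbour

  open AGEstimate (λ e → deg G (proj₁ e)) (λ e → deg G (proj₂ e)) (δ G)
                  (δ≤deg G ∘ proj₁) (δ≤deg G ∘ proj₂) (edges G)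
    using (AllEqualδ; terms≤bound; bound≤terms⇒allEqualδ; allEqualδ⇒bound≤terms)

  N : ℕ
  N = boundNumerator G

  AG≤bound : AG G ≤√ AGBound G
  AG≤bound = terms≤bound N (M₁²≤boundNumerator G)

  regular : AllEqualδ → Regular G
  regular allEqualδ i j = trans (deg≡δ i) (sym (deg≡δ j))
    where
    deg≡δ : ∀ i → deg G i ≡ δ G
    deg≡δ i = edge-endpoint G allEqualδ (proj₂ (neighbour i))

  allEqualδ : Regular G → AllEqualδ
  allEqualδ reg {e} _ = regular⇒deg≡δ G reg (proj₁ e) , regular⇒deg≡δ G reg (proj₂ e)
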